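{- Let $1\le\theta<\log_2 3$ be a real number and define $a_n=\lfloor n\theta\rfloor-\lfloor(n-1)\theta\rfloor$ for $n\ge1$. Then the E-sequence $(a_n)_{n\ge1}$ is $\Omega$-divergent.
   Context: An E-sequence is any infinite sequence $(a_n)_{n\ge1}$ of positive integers. For an odd positive integer $x$, its E-sequence is defined by $x_0=x$ and, for $n\ge1$, $x_n=\frac{3x_{n-1}+1}{2^{a_n}}$, where $a_n$ is the exponent of the largest power of $2$ dividing $3x_{n-1}+1$. An E-sequence is $\Omega$-divergent if it is not the E-sequence of any odd positive integer. -}

module Defs where

open import Data.Nat using (ℕ; zero; suc; _+_; _*_; _∸_; _^_; _≤_; _<_)
open import Data.Nat.Divisibility using (_∣_)
open import Data.Integer using (+_)
open import Data.Rational.Unnormalised using (ℚᵘ; mkℚᵘ; 1ℚᵘ; _≃_)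
  renaming (_<_ to _<ℚ_)
open import Data.Product using (Σ; ∃; _×_)
open import Data.Sum using (_⊎_)
open import Relation.Nullary using (¬_)
open import Relation.Binary.PropositionalEquality using (_≡_)

-- Real numbers as (two-sided, located) Dedekind cuts on unnormalised rationals.
-- L q  means  q < x ;  U q  means  x < q.
record Real : Set₁ where
  field
    L U      : ℚᵘ → Set
    L-resp   : ∀ {p q} → p ≃ q → L p → L q
    U-resp   : ∀ {p q} → p ≃ q → U p → U q
    L-inhab  : ∃ L
    U-inhab  : ∃ U
    L-lower  : ∀ {p q} → p <ℚ q → L q → L p
    L-round  : ∀ {q} → L q → ∃ λ r → q <ℚ r × L r
    U-upper  : ∀ {p q} → p <ℚ q → U p → U q
    U-round  : ∀ {q} → U q → ∃ λ r → r <ℚ q × U r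
    disjoint : ∀ q → ¬ (L q × U q)
    located  : ∀ {p q} → p <ℚ q → L p ⊎ U q

open Real public

_<ʳ_ : Real → ℚᵘ → Set
x <ʳ q = U x q

_≤ʳ'_ : ℚᵘ → Real → Set
q ≤ʳ' x = ¬ (U x q)

OneLe : Real → Set
OneLe θ = 1ℚᵘ ≤ʳ' θ

-- θ < log₂ 3 : some rational p/(k+1) with θ < p/(k+1) and 2^p < 3^(k+1)
-- (i.e. p/(k+1) < log₂ 3).
LtLog2of3 : Real → Set
LtLog2of3 θ = Σ ℕ λ p → Σ ℕ λ k → (θ <ʳ mkℚᵘ (+ p) k) × (2 ^ p < 3 ^ suc k)

-- F n = ⌊ n θ ⌋ for all n (θ ≥ 1 so these are naturals):
-- F 0 = 0, and for n = k+1:  F n / n ≤ θ < (F n + 1) / n.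
IsFloorMul : Real → (ℕ → ℕ) → Set
IsFloorMul θ F =
  (F 0 ≡ 0) ×
  (∀ k → (mkℚᵘ (+ F (suc k)) k ≤ʳ' θ) × (θ <ʳ mkℚᵘ (+ (F (suc k) + 1)) k))

-- Sequences a : ℕ → ℕ are indexed from 1 (a 0 is ignored).
-- a is the E-sequence of x: there is an orbit xs with xs 0 = x and
-- a(n+1) is the 2-adic valuation of 3 xs n + 1 and xs (n+1) = (3 xs n + 1)/2^a(n+1).
IsESeqOf : (ℕ → ℕ) → ℕ → Set
IsESeqOf a x = Σ (ℕ → ℕ) λ xs → (xs 0 ≡ x) ×
  (∀ n → (2 ^ a (suc n) ∣ 3 * xs n + 1)
       × ¬ (2 ^ suc (a (suc n)) ∣ 3 * xs n + 1)
       × (xs (suc n) * 2 ^ a (suc n) ≡ 3 * xs n + 1))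

OddPos : ℕ → Set
OddPos x = ¬ (2 ∣ x)   -- odd naturals are automatically positive

ΩDivergent : (ℕ → ℕ) → Set
ΩDivergent a = (∀ n → 1 ≤ a (suc n)) × ¬ (Σ ℕ λ x → OddPos x × IsESeqOf a x)

module Submission where

-- Let F n = ⌊nθ⌋ with 1 ≤ θ < log₂ 3, a (n+1) = F (n+1) - F n, and suppose an
-- orbit x₀, x₁, … of x ↦ (3x+1)/2^e has exactly these exponents.
-- 1. (FloorSequence, BalancedRows) F (u+k) = F u + F k + carry u k with carry 0 or 1,
--    and the carry rows never cross, so they are totally ordered.  A row is thus
--    fixed on [0,L) by its sum there, and by pigeonhole two of the rows 0 … L+1
--    agree on [0,L): the exponent blocks of length L at some i < j ≤ L+1 coincide.
-- 2. (CollatzOrbit) x_{u+t}·2^(G u t) = x_u·3^t + K, with G u t the exponent sum of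
--    the block and K depending only on the block; equal blocks force
--    x_{i+L} ≡ x_{j+L} (mod 3^L) unless x_i = x_j.  The growth bound
--    2^t(x_t+1) ≤ 3^t(x₀+1) keeps both below 3^L for L = 9(x₀+1), so x_i = x_j.
-- 3. (NoOrbit) A cycle of length d and exponent sum D has 3^d ≤ 2^D and makes F
--    rise by D every d steps, i.e. θ ≥ D/d ≥ log₂ 3, contradicting θ < log₂ 3.
-- General facts on sums, fractions, powers and divisibility come first.

open import Defs
open import Data.Nat
open import Data.Nat.Properties
open import Data.Nat.Divisibility using (_∣_; ∣m+n∣m⇒∣n; m∣m*n; ∣n⇒∣m*n; ∣-refl; ∣-trans; ∣⇒≤)
open import Data.Nat.Tactic.RingSolver using (solve-∀)
import Data.Integer as ℤ
import Data.Integer.Properties as ℤP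
open import Data.Rational.Unnormalised using (mkℚᵘ; *≤*) renaming (_≤_ to _≤ℚ_)
import Data.Rational.Unnormalised.Properties as ℚP
open import Data.Fin using (Fin; toℕ; fromℕ<)
import Data.Fin.Properties as FinP
open import Data.Product using (∃; _×_; _,_; proj₁; proj₂)
open import Data.Sum using (_⊎_; inj₁; inj₂)
open import Data.Empty using (⊥; ⊥-elim)
open import Relation.Nullary using (¬_; yes; no)
open import Relation.Binary.PropositionalEquality
open import Relation.Binary.Definitions using (tri<; tri≈; tri>)

Sum : (ℕ → ℕ) → ℕ → ℕ
Sum f zero    = 0
Sum f (suc L) = Sum f L + f L

Sum-cong : ∀ {f g} → (∀ k → f k ≡ g k) → ∀ L → Sum f L ≡ Sum g L
Sum-cong f≡g zero    = refl
Sum-cong f≡g (suc L) = cong₂ _+_ (Sum-cong f≡g L) (f≡g L)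

Sum-split : ∀ f m n → Sum f (m + n) ≡ Sum f m + Sum (λ k → f (m + k)) n
Sum-split f m zero rewrite +-identityʳ m = sym (+-identityʳ (Sum f m))
Sum-split f m (suc n) rewrite +-suc m n =
  trans (cong (_+ f (m + n)) (Sum-split f m n)) (+-assoc (Sum f m) _ (f (m + n)))

Sum-≤-length : ∀ {f} → (∀ k → f k ≤ 1) → ∀ L → Sum f L ≤ L
Sum-≤-length f≤1 zero    = z≤n
Sum-≤-length {f} f≤1 (suc L) = subst (Sum f L + f L ≤_) (+-comm L 1) (+-mono-≤ (Sum-≤-length f≤1 L) (f≤1 L))

Sum-mono : ∀ {f g} → (∀ k → f k ≤ g k) → ∀ L → Sum f L ≤ Sum g L
Sum-mono f≤g zero    = z≤n
Sum-mono f≤g (suc L) = +-mono-≤ (Sum-mono f≤g L) (f≤g L)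

Sum-strict : ∀ {f g k} → (∀ l → f l ≤ g l) → ∀ L → k < L → f k < g k → Sum f L < Sum g L
Sum-strict f≤g (suc L) k<1+L fk<gk with m≤n⇒m<n∨m≡n (≤-pred k<1+L)
... | inj₁ k<L  = +-mono-<-≤ (Sum-strict f≤g L k<L fk<gk) (f≤g L)
... | inj₂ refl = +-mono-≤-< (Sum-mono f≤g L) fk<gk

telescope : (f : ℕ → ℕ) → (∀ n → f n ≤ f (suc n)) →
            ∀ u t → f (u + t) ≡ f u + Sum (λ s → f (suc (u + s)) ∸ f (u + s)) t
telescope f mono u zero = trans (cong f (+-identityʳ u)) (sym (+-identityʳ (f u)))
telescope f mono u (suc t) = begin
  f (u + suc t)                           ≡⟨ cong f (+-suc u t) ⟩
  f (suc (u + t))                         ≡⟨ sym (m+[n∸m]≡n (mono (u + t))) ⟩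
  f (u + t) + (f (suc (u + t)) ∸ f (u + t)) ≡⟨ cong (_+ (f (suc (u + t)) ∸ f (u + t))) (telescope f mono u t) ⟩
  f u + S + (f (suc (u + t)) ∸ f (u + t))   ≡⟨ +-assoc (f u) S _ ⟩
  f u + (S + (f (suc (u + t)) ∸ f (u + t))) ∎
  where
  open ≡-Reasoning
  S = Sum (λ s → f (suc (u + s)) ∸ f (u + s)) t

-- Inequalities between fractions, written with cross-multiplied naturals.

sum-below-mediant : ∀ a b c u v → a * (u + v) < c * u → b * (u + v) < c * v → a + b < c
sum-below-mediant a b c u v p q =
  *-cancelʳ-< (u + v) (a + b) c (subst₂ _<_ (lhs a b u v) (rhs c u v) (+-mono-< p q))
  where
  lhs : ∀ a b u v → a * (u + v) + b * (u + v) ≡ (a + b) * (u + v)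
  lhs = solve-∀
  rhs : ∀ c u v → c * u + c * v ≡ c * (u + v)
  rhs = solve-∀

mediant-below-sum : ∀ a b c u v → a * u < b * (u + v) → a * v < c * (u + v) → a < b + c
mediant-below-sum a b c u v p q =
  *-cancelʳ-< (u + v) a (b + c) (subst₂ _<_ (lhs a u v) (rhs b c u v) (+-mono-< p q))
  where
  lhs : ∀ a u v → a * u + a * v ≡ a * (u + v)
  lhs = solve-∀
  rhs : ∀ b c u v → b * (u + v) + c * (u + v) ≡ (b + c) * (u + v)
  rhs = solve-∀

-- If A₁ + A₄ = B₂ + B₃ and N₁ + N₄ = N₂ + N₃, then A₁/N₁ and A₄/N₄ cannot both lie
-- strictly below both B₂/N₂ and B₃/N₃ (summing the four cross-multiplied
-- inequalities gives (B₂+B₃)(N₂+N₃) < (B₂+B₃)(N₂+N₃)).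
no-separation : ∀ A₁ A₄ B₂ B₃ N₁ N₂ N₃ N₄ → A₁ + A₄ ≡ B₂ + B₃ → N₁ + N₄ ≡ N₂ + N₃ →
  A₁ * N₂ < B₂ * N₁ → A₁ * N₃ < B₃ * N₁ → A₄ * N₂ < B₂ * N₄ → A₄ * N₃ < B₃ * N₄ → ⊥
no-separation A₁ A₄ B₂ B₃ N₁ N₂ N₃ N₄ eA eN p q r s = <-irrefl refl (begin-strict
  (B₂ + B₃) * (N₂ + N₃)                           ≡⟨ cong (_* (N₂ + N₃)) (sym eA) ⟩
  (A₁ + A₄) * (N₂ + N₃)                           ≡⟨ lhs A₁ A₄ N₂ N₃ ⟩
  A₁ * N₂ + A₁ * N₃ + (A₄ * N₂ + A₄ * N₃)         <⟨ +-mono-< (+-mono-< p q) (+-mono-< r s) ⟩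
  B₂ * N₁ + B₃ * N₁ + (B₂ * N₄ + B₃ * N₄)         ≡⟨ rhs B₂ B₃ N₁ N₄ ⟩
  (B₂ + B₃) * (N₁ + N₄)                           ≡⟨ cong ((B₂ + B₃) *_) eN ⟩
  (B₂ + B₃) * (N₂ + N₃)                           ∎)
  where
  open ≤-Reasoning
  lhs : ∀ a b m n → (a + b) * (m + n) ≡ a * m + a * n + (b * m + b * n)
  lhs = solve-∀
  rhs : ∀ a b m n → a * m + b * m + (a * n + b * n) ≡ (a + b) * (m + n)
  rhs = solve-∀

≤1⇒0⊎1 : ∀ {n} → n ≤ 1 → n ≡ 0 ⊎ n ≡ 1
≤1⇒0⊎1 z≤n       = inj₁ refl
≤1⇒0⊎1 (s≤s z≤n) = inj₂ refl

^-reflects-< : ∀ b .{{_ : NonZero b}} {m n} → b ^ m < b ^ n → m < n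
^-reflects-< b {m} {n} bᵐ<bⁿ with m <? n
... | yes m<n = m<n
... | no  m≮n = ⊥-elim (<⇒≱ bᵐ<bⁿ (^-monoʳ-≤ b (≮⇒≥ m≮n)))

^-∣-^ : ∀ b {m n} → m ≤ n → b ^ m ∣ b ^ n
^-∣-^ b {m} m≤n with m≤n⇒∃[o]m+o≡n m≤n
... | o , refl = subst (b ^ m ∣_) (sym (^-distribˡ-+-* b m o)) (m∣m*n (b ^ o))

valuation-unique : ∀ b N {m n} → b ^ m ∣ N → ¬ (b ^ suc m ∣ N) →
                   b ^ n ∣ N → ¬ (b ^ suc n ∣ N) → m ≡ n
valuation-unique b N {m} {n} bᵐ∣N bᵐ⁺¹∤N bⁿ∣N bⁿ⁺¹∤N with <-cmp m n
... | tri< m<n _ _ = ⊥-elim (bᵐ⁺¹∤N (∣-trans (^-∣-^ b m<n) bⁿ∣N))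
... | tri≈ _ m≡n _ = m≡n
... | tri> _ _ n<m = ⊥-elim (bⁿ⁺¹∤N (∣-trans (^-∣-^ b n<m) bᵐ∣N))

odd-pow3 : ∀ L → ∃ λ h → 3 ^ L ≡ 2 * h + 1
odd-pow3 zero    = 0 , refl
odd-pow3 (suc L) with odd-pow3 L
... | h , 3ᴸ≡2h+1 = 3 * h + 1 , trans (cong (3 *_) 3ᴸ≡2h+1) (step h)
  where
  step : ∀ h → 3 * (2 * h + 1) ≡ 2 * (3 * h + 1) + 1
  step = solve-∀

-- An odd number dividing 2z divides z, as (h+1)·2z = (2h+1)·z + z.
odd-∣-double : ∀ h z → 2 * h + 1 ∣ 2 * z → 2 * h + 1 ∣ z
odd-∣-double h z m∣2z = ∣m+n∣m⇒∣n (subst (2 * h + 1 ∣_) (split h z) (∣n⇒∣m*n (suc h) m∣2z)) (m∣m*n z)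
  where
  split : ∀ h z → suc h * (2 * z) ≡ (2 * h + 1) * z + z
  split = solve-∀

pow3-∣-*pow2 : ∀ L n y → 3 ^ L ∣ y * 2 ^ n → 3 ^ L ∣ y
pow3-∣-*pow2 L zero    y 3ᴸ∣y·1 = subst (3 ^ L ∣_) (*-identityʳ y) 3ᴸ∣y·1
pow3-∣-*pow2 L (suc n) y 3ᴸ∣y·2ⁿ⁺¹ with odd-pow3 L
... | h , 3ᴸ≡2h+1 = pow3-∣-*pow2 L n y
      (subst (_∣ y * 2 ^ n) (sym 3ᴸ≡2h+1)
        (odd-∣-double h (y * 2 ^ n) (subst₂ _∣_ 3ᴸ≡2h+1 (reassoc y (2 ^ n)) 3ᴸ∣y·2ⁿ⁺¹)))
  where
  reassoc : ∀ y p → y * (2 * p) ≡ 2 * (y * p)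
  reassoc = solve-∀

-- If y₁ 2ⁿ = z₁ 3ᴸ + C and y₂ 2ⁿ = z₂ 3ᴸ + C with z₁ < z₂, then 3ᴸ divides the
-- positive number y₂ - y₁, so y₂ ≥ 3ᴸ.
affine-gap : ∀ L n C {y₁ y₂ z₁ z₂} → y₁ * 2 ^ n ≡ z₁ * 3 ^ L + C → y₂ * 2 ^ n ≡ z₂ * 3 ^ L + C →
             z₁ < z₂ → 3 ^ L ≤ y₂
affine-gap L n C {y₁} {y₂} {z₁} {z₂} e₁ e₂ z₁<z₂ =
  ≤-trans (∣⇒≤ {{≢-nonZero Δy≢0}} (pow3-∣-*pow2 L n (y₂ ∸ y₁) 3ᴸ∣Δy·2ⁿ)) (m∸n≤m y₂ y₁)
  where
  open ≡-Reasoning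
  differences : (y₂ ∸ y₁) * 2 ^ n ≡ (z₂ ∸ z₁) * 3 ^ L
  differences = begin
    (y₂ ∸ y₁) * 2 ^ n                       ≡⟨ *-distribʳ-∸ (2 ^ n) y₂ y₁ ⟩
    y₂ * 2 ^ n ∸ y₁ * 2 ^ n                 ≡⟨ cong₂ _∸_ (trans e₂ (+-comm _ C)) (trans e₁ (+-comm _ C)) ⟩
    (C + z₂ * 3 ^ L) ∸ (C + z₁ * 3 ^ L)     ≡⟨ [m+n]∸[m+o]≡n∸o C (z₂ * 3 ^ L) (z₁ * 3 ^ L) ⟩
    z₂ * 3 ^ L ∸ z₁ * 3 ^ L                 ≡⟨ sym (*-distribʳ-∸ (3 ^ L) z₂ z₁) ⟩
    (z₂ ∸ z₁) * 3 ^ L                       ∎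
  3ᴸ∣Δy·2ⁿ : 3 ^ L ∣ (y₂ ∸ y₁) * 2 ^ n
  3ᴸ∣Δy·2ⁿ = subst (3 ^ L ∣_) (sym differences) (∣n⇒∣m*n (z₂ ∸ z₁) ∣-refl)
  Δy≢0 : y₂ ∸ y₁ ≢ 0
  Δy≢0 Δy≡0 = <-irrefl refl (≤-trans (*-mono-≤ (m<n⇒0<n∸m z₁<z₂) (m^n>0 3 L))
                (≤-reflexive (trans (sym differences) (cong (_* 2 ^ n) Δy≡0))))

affine-collision : ∀ L n C {y₁ y₂ z₁ z₂} → y₁ * 2 ^ n ≡ z₁ * 3 ^ L + C → y₂ * 2 ^ n ≡ z₂ * 3 ^ L + C →
                   y₁ < 3 ^ L → y₂ < 3 ^ L → z₁ ≡ z₂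
affine-collision L n C {y₁} {y₂} {z₁} {z₂} e₁ e₂ y₁<3ᴸ y₂<3ᴸ with <-cmp z₁ z₂
... | tri< z₁<z₂ _ _ = ⊥-elim (<⇒≱ y₂<3ᴸ (affine-gap L n C {y₁} {y₂} e₁ e₂ z₁<z₂))
... | tri≈ _ z₁≡z₂ _ = z₁≡z₂
... | tri> _ _ z₂<z₁ = ⊥-elim (<⇒≱ y₁<3ᴸ (affine-gap L n C {y₂} {y₁} e₂ e₁ z₂<z₁))

-- 3ᴸ (L + 3) ≤ 3 · 4ᴸ, by induction (the ratio of successive left sides is at most 4).
pow3-vs-pow4 : ∀ L → 3 ^ L * (L + 3) ≤ 3 * (2 ^ L * 2 ^ L)
pow3-vs-pow4 zero    = ≤-refl
pow3-vs-pow4 (suc L) = begin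
  3 * 3 ^ L * (suc L + 3)                 ≤⟨ m≤m+n _ (3 ^ L * L) ⟩
  3 * 3 ^ L * (suc L + 3) + 3 ^ L * L     ≡⟨ regroup (3 ^ L) L ⟩
  4 * (3 ^ L * (L + 3))                   ≤⟨ *-monoʳ-≤ 4 (pow3-vs-pow4 L) ⟩
  4 * (3 * (2 ^ L * 2 ^ L))               ≡⟨ double (2 ^ L) ⟩
  3 * (2 * 2 ^ L * (2 * 2 ^ L))           ∎
  where
  open ≤-Reasoning
  regroup : ∀ a L → 3 * a * (suc L + 3) + a * L ≡ 4 * (a * (L + 3))
  regroup = solve-∀
  double : ∀ q → 4 * (3 * (q * q)) ≡ 3 * (2 * q * (2 * q))
  double = solve-∀

window-estimate : ∀ c L → 9 * c ≤ L → 3 ^ suc (L + L) * c < 2 ^ suc (L + L) * 3 ^ L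
window-estimate c L 9c≤L = begin-strict
  3 ^ suc (L + L) * c     ≡⟨ cong (λ z → 3 * z * c) (^-distribˡ-+-* 3 L L) ⟩
  3 * (a * a) * c         ≡⟨ regroup₁ a c ⟩
  a * (3 * a * c)         <⟨ *-monoʳ-< a {{m^n≢0 3 L}} 3ac<2qq ⟩
  a * (2 * (q * q))       ≡⟨ regroup₂ a q ⟩
  2 * (q * q) * a         ≡⟨ cong (λ z → 2 * z * a) (sym (^-distribˡ-+-* 2 L L)) ⟩
  2 ^ suc (L + L) * a     ∎
  where
  open ≤-Reasoning
  a = 3 ^ L
  q = 2 ^ L
  regroup₁ : ∀ a c → 3 * (a * a) * c ≡ a * (3 * a * c)
  regroup₁ = solve-∀
  regroup₂ : ∀ a q → a * (2 * (q * q)) ≡ 2 * (q * q) * a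
  regroup₂ = solve-∀
  nine : ∀ a c → 3 * (3 * a * c) ≡ a * (9 * c)
  nine = solve-∀
  3ac<2qq : 3 * a * c < 2 * (q * q)
  3ac<2qq = *-cancelˡ-< 3 _ _ (begin-strict
    3 * (3 * a * c)       ≡⟨ nine a c ⟩
    a * (9 * c)           <⟨ *-monoʳ-< a {{m^n≢0 3 L}} (≤-<-trans 9c≤L (m<m+n L z<s)) ⟩
    a * (L + 3)           ≤⟨ pow3-vs-pow4 L ⟩
    3 * (q * q)           ≤⟨ *-monoʳ-≤ 3 (m≤m+n (q * q) (q * q + 0)) ⟩
    3 * (2 * (q * q))     ∎)

-- The rational A/(1+n) is at most θ, resp. B/(1+m) is strictly above θ.
FracBelow : Real → ℕ → ℕ → Set
FracBelow θ A n = ¬ U θ (mkℚᵘ (ℤ.+ A) n)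

FracAbove : Real → ℕ → ℕ → Set
FracAbove θ B m = U θ (mkℚᵘ (ℤ.+ B) m)

below-above⇒< : ∀ θ {A n B m} → FracBelow θ A n → FracAbove θ B m → A * suc m < B * suc n
below-above⇒< θ {A} {n} {B} {m} A≤θ θ<B with A * suc m <? B * suc n
... | yes lt = lt
... | no  ≮ = ⊥-elim (A≤θ (U-upper θ (ℚP.<-≤-trans r<B B≤A) θ<r))
  where
  -- θ < B/(1+m) ≤ A/(1+n) would put A/(1+n) in the upper cut of θ.
  B≤A : mkℚᵘ (ℤ.+ B) m ≤ℚ mkℚᵘ (ℤ.+ A) n
  B≤A = *≤* (subst₂ ℤ._≤_ (ℤP.pos-* B (suc n)) (ℤP.pos-* A (suc m)) (ℤ.+≤+ (≮⇒≥ ≮)))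
  r<B = proj₁ (proj₂ (U-round θ θ<B))
  θ<r = proj₂ (proj₂ (U-round θ θ<B))

-- The floor sequence F n = ⌊nθ⌋ of a real θ ≥ 1.

module FloorSequence (θ : Real) (one : OneLe θ) (F : ℕ → ℕ) (isF : IsFloorMul θ F) where

  F0 : F 0 ≡ 0
  F0 = proj₁ isF

  F-below : ∀ n → FracBelow θ (F (suc n)) n
  F-below n = proj₁ (proj₂ isF n)

  F-above : ∀ n → FracAbove θ (F (suc n) + 1) n
  F-above n = proj₂ (proj₂ isF n)

  -- F u/u ≤ θ and F k/k ≤ θ lie below (F (u+k) + 1)/(u+k), so F u + F k < F (u+k) + 1.
  superadditive : ∀ u k → F u + F k ≤ F (u + k)
  superadditive zero    k rewrite F0 = ≤-refl
  superadditive (suc u) zero rewrite F0 | +-identityʳ u | +-identityʳ (F (suc u)) = ≤-refl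
  superadditive (suc u) (suc k) = ≤-pred (subst (F (suc u) + F (suc k) <_) (+-comm (F (suc u + suc k)) 1)
    (sum-below-mediant (F (suc u)) (F (suc k)) (F (suc u + suc k) + 1) (suc u) (suc k)
      (below-above⇒< θ (F-below u) (F-above (u + suc k)))
      (below-above⇒< θ (F-below k) (F-above (u + suc k)))))

  -- Dually F (u+k)/(u+k) ≤ θ lies below (F u + 1)/u and (F k + 1)/k.
  almost-subadditive : ∀ u k → F (u + k) < F u + F k + 2
  almost-subadditive zero k rewrite F0 | +-comm (F k) 2 = ≤-trans (n<1+n (F k)) (n≤1+n _)
  almost-subadditive (suc u) zero
    rewrite F0 | +-identityʳ u | +-identityʳ (F (suc u)) | +-comm (F (suc u)) 2 = ≤-trans (n<1+n _) (n≤1+n _)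
  almost-subadditive (suc u) (suc k) = subst (F (suc u + suc k) <_) (regroup (F (suc u)) (F (suc k)))
    (mediant-below-sum (F (suc u + suc k)) (F (suc u) + 1) (F (suc k) + 1) (suc u) (suc k)
      (below-above⇒< θ (F-below (u + suc k)) (F-above u))
      (below-above⇒< θ (F-below (u + suc k)) (F-above k)))
    where
    regroup : ∀ a b → a + 1 + (b + 1) ≡ a + b + 2
    regroup = solve-∀

  carry : ℕ → ℕ → ℕ
  carry u k = F (u + k) ∸ (F u + F k)

  F-split : ∀ u k → F (u + k) ≡ F u + F k + carry u k
  F-split u k = sym (m+[n∸m]≡n (superadditive u k))

  carry≤1 : ∀ u k → carry u k ≤ 1
  carry≤1 u k = ≤-pred (+-cancelˡ-< (F u + F k) _ _
    (subst (_< F u + F k + 2) (F-split u k) (almost-subadditive u k)))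

  F-increasing : ∀ n → F n < F (suc n)
  F-increasing n = begin
    1 + F n        ≡⟨ +-comm 1 (F n) ⟩
    F n + 1        ≤⟨ +-monoʳ-≤ (F n) F1≥1 ⟩
    F n + F 1      ≤⟨ superadditive n 1 ⟩
    F (n + 1)      ≡⟨ cong F (+-comm n 1) ⟩
    F (suc n)      ∎
    where
    open ≤-Reasoning
    F1≥1 : 1 ≤ F 1
    F1≥1 = ≤-pred (subst (1 <_) (trans (*-identityʳ (F 1 + 1)) (+-comm (F 1) 1))
      (below-above⇒< θ {1} {0} one (F-above 0)))

  -- Carry 1 at (u, k+1) means (F u + F(k+1) + 1)/(u+k+1) ≤ θ
  -- and carry 0 means θ < that fraction.  Carries 1, 0 at (i, k+1), (j, k+1) and 0, 1 at
  -- (i, l+1), (j, l+1) would put the two "carry 1" fractions strictly below the two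
  -- "carry 0" fractions, although both pairs have the same numerator and denominator sums.
  carry-no-crossing : ∀ {i j k l} → carry i (suc k) ≡ 1 → carry j (suc k) ≡ 0 →
                      carry i (suc l) ≡ 0 → carry j (suc l) ≡ 1 → ⊥
  carry-no-crossing {i} {j} {k} {l} ik≡1 jk≡0 il≡0 jl≡1 =
    no-separation (F i + F (suc k) + 1) (F j + F (suc l) + 1)
                  (F j + F (suc k) + 1) (F i + F (suc l) + 1)
                  (suc (i + k)) (suc (j + k)) (suc (i + l)) (suc (j + l))
                  (numerators (F i) (F j) (F (suc k)) (F (suc l))) (denominators i j k l)
                  (below-above⇒< θ (carry1-below ik≡1) (carry0-above jk≡0))
                  (below-above⇒< θ (carry1-below ik≡1) (carry0-above il≡0))
                  (below-above⇒< θ (carry1-below jl≡1) (carry0-above jk≡0))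
                  (below-above⇒< θ (carry1-below jl≡1) (carry0-above il≡0))
    where
    numerators : ∀ a b x y → a + x + 1 + (b + y + 1) ≡ b + x + 1 + (a + y + 1)
    numerators = solve-∀
    denominators : ∀ i j k l → suc (i + k) + suc (j + l) ≡ suc (j + k) + suc (i + l)
    denominators = solve-∀
    F-at : ∀ u k → F (suc (u + k)) ≡ F u + F (suc k) + carry u (suc k)
    F-at u k = trans (cong F (sym (+-suc u k))) (F-split u (suc k))
    carry1-below : ∀ {u k} → carry u (suc k) ≡ 1 → FracBelow θ (F u + F (suc k) + 1) (u + k)
    carry1-below {u} {k} c≡1 = subst (λ z → FracBelow θ z (u + k))
      (trans (F-at u k) (cong (F u + F (suc k) +_) c≡1)) (F-below (u + k))
    carry0-above : ∀ {u k} → carry u (suc k) ≡ 0 → FracAbove θ (F u + F (suc k) + 1) (u + k)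
    carry0-above {u} {k} c≡0 = subst (λ z → FracAbove θ (z + 1) (u + k))
      (trans (F-at u k) (trans (cong (F u + F (suc k) +_) c≡0) (+-identityʳ _))) (F-above (u + k))

  -- F cannot increase by D along every step of length d ≥ 1 when 3^d ≤ 2^D:
  -- that slope D/d ≥ log₂ 3 exceeds a rational p/u > θ with 2^p < 3^u, while
  -- F (i + td) ≤ (i + td)·p/u; taking t = p·i + 1 gives the contradiction.
  no-steep-progression : LtLog2of3 θ → ∀ i e D → 3 ^ suc e ≤ 2 ^ D →
                         (∀ t → F (i + t * suc e) ≡ F i + t * D) → ⊥
  no-steep-progression (p , k , θ<p/u , 2ᵖ<3ᵘ) i e D 3ᵈ≤2ᴰ progression = <-irrefl refl (begin-strict
    t * D * u                 ≤⟨ *-monoˡ-≤ u (subst (t * D ≤_) (sym (progression t)) (m≤n+m (t * D) (F i))) ⟩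
    F N * u                   <⟨ F-slope ⟩
    p * N                     ≡⟨ expand p i t d ⟩
    p * i + t * (p * d)       <⟨ +-monoˡ-< (t * (p * d)) (n<1+n (p * i)) ⟩
    t + t * (p * d)           ≡⟨ sym (*-suc t (p * d)) ⟩
    t * suc (p * d)           ≤⟨ *-monoʳ-≤ t pd<uD ⟩
    t * (u * D)               ≡⟨ regroup t u D ⟩
    t * D * u                 ∎)
    where
    open ≤-Reasoning
    d = suc e
    u = suc k
    t = suc (p * i)
    N = i + t * d
    expand : ∀ p i t d → p * (i + t * d) ≡ p * i + t * (p * d)
    expand = solve-∀
    regroup : ∀ t u D → t * (u * D) ≡ t * D * u
    regroup = solve-∀
    pd<uD : p * d < u * D
    pd<uD = ^-reflects-< 2 (begin-strict
      2 ^ (p * d)      ≡⟨ sym (^-*-assoc 2 p d) ⟩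
      (2 ^ p) ^ d      <⟨ ^-monoˡ-< d 2ᵖ<3ᵘ ⟩
      (3 ^ u) ^ d      ≡⟨ trans (^-*-assoc 3 u d) (trans (cong (3 ^_) (*-comm u d)) (sym (^-*-assoc 3 d u))) ⟩
      (3 ^ d) ^ u      ≤⟨ ^-monoˡ-≤ u 3ᵈ≤2ᴰ ⟩
      (2 ^ D) ^ u      ≡⟨ trans (^-*-assoc 2 D u) (cong (2 ^_) (*-comm D u)) ⟩
      2 ^ (u * D)      ∎)
    -- F N / N ≤ θ < p/u.
    F-slope : F N * u < p * N
    F-slope = subst (λ z → F z * u < p * z) (sym (+-suc i (e + p * i * d)))
      (below-above⇒< θ (F-below (i + (e + p * i * d))) θ<p/u)

-- Rows of 0/1 values that never cross are totally ordered, so two rows with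
-- the same sum over [0, L) agree there; by pigeonhole two of the rows 0 … L+1 do.

module BalancedRows (r : ℕ → ℕ → ℕ) (r≤1 : ∀ i k → r i k ≤ 1)
  (no-crossing : ∀ {i j k l} → r i k ≡ 1 → r j k ≡ 0 → r i l ≡ 0 → r j l ≡ 1 → ⊥) where

  dominated : ∀ {i j k} → r i k ≡ 1 → r j k ≡ 0 → ∀ l → r j l ≤ r i l
  dominated {i} {j} ik≡1 jk≡0 l with ≤1⇒0⊎1 (r≤1 i l) | ≤1⇒0⊎1 (r≤1 j l)
  ... | _        | inj₁ jl≡0 = subst (_≤ r i l) (sym jl≡0) z≤n
  ... | inj₂ il≡1 | inj₂ jl≡1 = ≤-reflexive (trans jl≡1 (sym il≡1))
  ... | inj₁ il≡0 | inj₂ jl≡1 = ⊥-elim (no-crossing ik≡1 jk≡0 il≡0 jl≡1)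

  equal-sums⇒equal-rows : ∀ {i j} L → Sum (r i) L ≡ Sum (r j) L → ∀ k → k < L → r i k ≡ r j k
  equal-sums⇒equal-rows {i} {j} L sums k k<L with ≤1⇒0⊎1 (r≤1 i k) | ≤1⇒0⊎1 (r≤1 j k)
  ... | inj₁ ik≡0 | inj₁ jk≡0 = trans ik≡0 (sym jk≡0)
  ... | inj₂ ik≡1 | inj₂ jk≡1 = trans ik≡1 (sym jk≡1)
  ... | inj₂ ik≡1 | inj₁ jk≡0 =
    ⊥-elim (<-irrefl (sym sums) (Sum-strict (dominated ik≡1 jk≡0) L k<L (subst₂ _<_ (sym jk≡0) (sym ik≡1) z<s)))
  ... | inj₁ ik≡0 | inj₂ jk≡1 =
    ⊥-elim (<-irrefl sums (Sum-strict (dominated jk≡1 ik≡0) L k<L (subst₂ _<_ (sym ik≡0) (sym jk≡1) z<s)))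

  -- The sum of row i over [0, L), for the L+2 rows i ≤ L+1; it is at most L.
  row-sum : ∀ L → Fin (suc (suc L)) → Fin (suc L)
  row-sum L i = fromℕ< (s≤s (Sum-≤-length (r≤1 (toℕ i)) L))

  repeated-prefix : ∀ L → ∃ λ i → ∃ λ j → i < j × j ≤ suc L × (∀ k → k < L → r i k ≡ r j k)
  repeated-prefix L with FinP.pigeonhole (n<1+n (suc L)) (row-sum L)
  ... | a , b , a<b , sa≡sb =
    toℕ a , toℕ b , a<b , ≤-pred (FinP.toℕ<n b) ,
    equal-sums⇒equal-rows L (trans (sym (FinP.toℕ-fromℕ< _)) (trans (cong toℕ sa≡sb) (FinP.toℕ-fromℕ< _)))

-- Orbits of x ↦ (3x + 1)/2^e with prescribed exact exponents.

CollatzStep : (ℕ → ℕ) → (ℕ → ℕ) → ℕ → Set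
CollatzStep a xs n = (2 ^ a n ∣ 3 * xs n + 1) × ¬ (2 ^ suc (a n) ∣ 3 * xs n + 1)
                   × (xs (suc n) * 2 ^ a n ≡ 3 * xs n + 1)

-- K g t is the result of the affine steps y ↦ 3y + 2^(g s), s = 0 … t-1, from y = 0;
-- it is the additive term of the orbit formula, with g the partial exponent sums.
K : (ℕ → ℕ) → ℕ → ℕ
K g zero    = 0
K g (suc t) = 3 * K g t + 2 ^ g t

K-cong : ∀ {g h} t → (∀ s → s < t → g s ≡ h s) → K g t ≡ K h t
K-cong zero    g≡h = refl
K-cong (suc t) g≡h = cong₂ (λ x y → 3 * x + 2 ^ y) (K-cong t (λ s s<t → g≡h s (m<n⇒m<1+n s<t))) (g≡h t ≤-refl)

module CollatzOrbit (a : ℕ → ℕ) (a≥1 : ∀ n → 1 ≤ a n) (xs : ℕ → ℕ)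
  (step : ∀ n → CollatzStep a xs n) where

  orbit-eq : ∀ n → xs (suc n) * 2 ^ a n ≡ 3 * xs n + 1
  orbit-eq n = proj₂ (proj₂ (step n))

  G : ℕ → ℕ → ℕ
  G u = Sum (λ s → a (u + s))

  orbit-affine : ∀ u t → xs (u + t) * 2 ^ G u t ≡ xs u * 3 ^ t + K (G u) t
  orbit-affine u zero rewrite +-identityʳ u = trans (*-identityʳ (xs u)) (sym (trans (+-identityʳ _) (*-identityʳ (xs u))))
  orbit-affine u (suc t) rewrite +-suc u t = begin
    xs (suc m) * 2 ^ (G u t + a m)          ≡⟨ cong (xs (suc m) *_) (^-distribˡ-+-* 2 (G u t) (a m)) ⟩
    xs (suc m) * (2 ^ G u t * 2 ^ a m)      ≡⟨ swap (xs (suc m)) (2 ^ G u t) (2 ^ a m) ⟩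
    xs (suc m) * 2 ^ a m * 2 ^ G u t        ≡⟨ cong (_* 2 ^ G u t) (orbit-eq m) ⟩
    (3 * xs m + 1) * 2 ^ G u t              ≡⟨ distrib (xs m) (2 ^ G u t) ⟩
    3 * (xs m * 2 ^ G u t) + 2 ^ G u t      ≡⟨ cong (λ z → 3 * z + 2 ^ G u t) (orbit-affine u t) ⟩
    3 * (xs u * 3 ^ t + K (G u) t) + 2 ^ G u t ≡⟨ regroup (xs u) (3 ^ t) (K (G u) t) (2 ^ G u t) ⟩
    xs u * (3 * 3 ^ t) + (3 * K (G u) t + 2 ^ G u t) ∎
    where
    open ≡-Reasoning
    m = u + t
    swap : ∀ x p q → x * (p * q) ≡ x * q * p
    swap = solve-∀
    distrib : ∀ x p → (3 * x + 1) * p ≡ 3 * (x * p) + p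
    distrib = solve-∀
    regroup : ∀ x q c p → 3 * (x * q + c) + p ≡ x * (3 * q) + (3 * c + p)
    regroup = solve-∀

  -- x_n = 0 would give x_{n+1} · 2^(a n) = 1, impossible as a n ≥ 1.
  xs-positive : ∀ n → 1 ≤ xs n
  xs-positive n with xs n in xsn≡
  ... | suc _ = s≤s z≤n
  ... | zero  = ⊥-elim (<⇒≱ (^-monoʳ-≤ 2 (a≥1 n)) (≤-reflexive (m*n≡1⇒n≡1 (xs (suc n)) (2 ^ a n)
                  (trans (orbit-eq n) (cong (λ z → 3 * z + 1) xsn≡)))))

  -- Each step at most multiplies x + 1 by 3/2:  2ᵗ(xₜ + 1) ≤ 3ᵗ(x₀ + 1).
  growth-bound : ∀ t → 2 ^ t * (xs t + 1) ≤ 3 ^ t * (xs 0 + 1)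
  growth-bound zero    = ≤-refl
  growth-bound (suc t) = begin
    2 * 2 ^ t * (xs (suc t) + 1)            ≡⟨ regroup₁ (2 ^ t) (xs (suc t)) ⟩
    2 ^ t * (xs (suc t) * 2 + 2)            ≤⟨ *-monoʳ-≤ (2 ^ t) (+-monoˡ-≤ 2 (*-monoʳ-≤ (xs (suc t)) (^-monoʳ-≤ 2 (a≥1 t)))) ⟩
    2 ^ t * (xs (suc t) * 2 ^ a t + 2)      ≡⟨ cong (λ z → 2 ^ t * (z + 2)) (orbit-eq t) ⟩
    2 ^ t * (3 * xs t + 1 + 2)              ≡⟨ regroup₂ (2 ^ t) (xs t) ⟩
    3 * (2 ^ t * (xs t + 1))                ≤⟨ *-monoʳ-≤ 3 (growth-bound t) ⟩
    3 * (3 ^ t * (xs 0 + 1))                ≡⟨ sym (*-assoc 3 (3 ^ t) _) ⟩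
    3 * 3 ^ t * (xs 0 + 1)                  ∎
    where
    open ≤-Reasoning
    regroup₁ : ∀ p y → 2 * p * (y + 1) ≡ p * (y * 2 + 2)
    regroup₁ = solve-∀
    regroup₂ : ∀ p y → p * (3 * y + 1 + 2) ≡ 3 * (p * (y + 1))
    regroup₂ = solve-∀

  -- The same bound at a later horizon T ≥ t, since 2^(T-t) ≤ 3^(T-t).
  growth-bound-until : ∀ t T → t ≤ T → 2 ^ T * (xs t + 1) ≤ 3 ^ T * (xs 0 + 1)
  growth-bound-until t T t≤T with m≤n⇒∃[o]m+o≡n t≤T
  ... | e , refl = begin
    2 ^ (t + e) * (xs t + 1)          ≡⟨ cong (_* (xs t + 1)) (^-distribˡ-+-* 2 t e) ⟩
    2 ^ t * 2 ^ e * (xs t + 1)        ≡⟨ regroup (2 ^ t) (2 ^ e) (xs t + 1) ⟩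
    2 ^ e * (2 ^ t * (xs t + 1))      ≤⟨ *-mono-≤ (^-monoˡ-≤ e (s≤s (s≤s z≤n))) (growth-bound t) ⟩
    3 ^ e * (3 ^ t * (xs 0 + 1))      ≡⟨ sym (regroup (3 ^ t) (3 ^ e) (xs 0 + 1)) ⟩
    3 ^ t * 3 ^ e * (xs 0 + 1)        ≡⟨ cong (_* (xs 0 + 1)) (sym (^-distribˡ-+-* 3 t e)) ⟩
    3 ^ (t + e) * (xs 0 + 1)          ∎
    where
    open ≤-Reasoning
    regroup : ∀ a b c → a * b * c ≡ b * (a * c)
    regroup = solve-∀

  -- The window length: on [0, 2W+1] the orbit stays below 3ᵂ.
  W : ℕ
  W = 9 * (xs 0 + 1)

  bounded-on-window : ∀ t → t ≤ suc (W + W) → xs t < 3 ^ W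
  bounded-on-window t t≤T = ≤-trans (s≤s (m≤m+n (xs t) 1)) (*-cancelˡ-< (2 ^ T) _ _ (begin-strict
    2 ^ T * (xs t + 1)     ≤⟨ growth-bound-until t T t≤T ⟩
    3 ^ T * (xs 0 + 1)     <⟨ window-estimate (xs 0 + 1) W ≤-refl ⟩
    2 ^ T * 3 ^ W          ∎))
    where
    open ≤-Reasoning
    T = suc (W + W)

  collision : ∀ i j L → (∀ s → s ≤ L → G i s ≡ G j s) →
              xs (i + L) < 3 ^ L → xs (j + L) < 3 ^ L → xs i ≡ xs j
  collision i j L blocks small-i small-j =
    affine-collision L (G i L) (K (G i) L) (orbit-affine i L)
      (subst₂ (λ g c → xs (j + L) * 2 ^ g ≡ xs j * 3 ^ L + c)
         (sym (blocks L ≤-refl)) (sym (K-cong L (λ s s<L → blocks s (<⇒≤ s<L)))) (orbit-affine j L))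
      small-i small-j

  -- The current value determines the exponent (its exact 2-adic valuation of 3x+1)
  -- and hence the next value.
  orbit-determined : ∀ {m n} → xs m ≡ xs n → xs (suc m) ≡ xs (suc n) × a m ≡ a n
  orbit-determined {m} {n} xm≡xn = *-cancelʳ-≡ _ _ (2 ^ a n) {{m^n≢0 2 (a n)}} (begin
      xs (suc m) * 2 ^ a n   ≡⟨ cong (λ e → xs (suc m) * 2 ^ e) (sym am≡an) ⟩
      xs (suc m) * 2 ^ a m   ≡⟨ orbit-eq m ⟩
      3 * xs m + 1           ≡⟨ cong (λ z → 3 * z + 1) xm≡xn ⟩
      3 * xs n + 1           ≡⟨ sym (orbit-eq n) ⟩
      xs (suc n) * 2 ^ a n   ∎) , am≡an
    where
    open ≡-Reasoning
    am≡an : a m ≡ a n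
    am≡an = valuation-unique 2 (3 * xs m + 1) (proj₁ (step m)) (proj₁ (proj₂ (step m)))
      (subst (λ z → 2 ^ a n ∣ 3 * z + 1) (sym xm≡xn) (proj₁ (step n)))
      (subst (λ z → ¬ (2 ^ suc (a n) ∣ 3 * z + 1)) (sym xm≡xn) (proj₁ (proj₂ (step n))))

  cycle-repeats : ∀ {i d} → xs (i + d) ≡ xs i → ∀ s → xs (i + (d + s)) ≡ xs (i + s)
  cycle-repeats {i} {d} cyc zero rewrite +-identityʳ d | +-identityʳ i = cyc
  cycle-repeats {i} {d} cyc (suc s) rewrite +-suc d s | +-suc i (d + s) | +-suc i s =
    proj₁ (orbit-determined (cycle-repeats cyc s))

  cycle-exponents : ∀ {i d} → xs (i + d) ≡ xs i → ∀ t → G i (t * d) ≡ t * G i d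
  cycle-exponents {i} {d} cyc zero    = refl
  cycle-exponents {i} {d} cyc (suc t) = begin
    G i (d + t * d)                                  ≡⟨ Sum-split (λ s → a (i + s)) d (t * d) ⟩
    G i d + Sum (λ s → a (i + (d + s))) (t * d)      ≡⟨ cong (G i d +_) (Sum-cong periodic (t * d)) ⟩
    G i d + G i (t * d)                              ≡⟨ cong (G i d +_) (cycle-exponents cyc t) ⟩
    G i d + t * G i d                                ∎
    where
    open ≡-Reasoning
    periodic : ∀ s → a (i + (d + s)) ≡ a (i + s)
    periodic s = proj₂ (orbit-determined (cycle-repeats cyc s))

  -- Around a cycle  x·2^D = x·3^d + K ≥ x·3^d,  so 3^d ≤ 2^D.
  cycle-growth : ∀ {i d} → xs (i + d) ≡ xs i → 3 ^ d ≤ 2 ^ G i d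
  cycle-growth {i} {d} cyc = *-cancelˡ-≤ (xs i) {{>-nonZero (xs-positive i)}} (begin
    xs i * 3 ^ d                 ≤⟨ m≤m+n _ (K (G i) d) ⟩
    xs i * 3 ^ d + K (G i) d     ≡⟨ sym (orbit-affine i d) ⟩
    xs (i + d) * 2 ^ G i d       ≡⟨ cong (_* 2 ^ G i d) cyc ⟩
    xs i * 2 ^ G i d             ∎)
    where open ≤-Reasoning

module NoOrbit (θ : Real) (one : OneLe θ) (F : ℕ → ℕ) (isF : IsFloorMul θ F) where
  open FloorSequence θ one F isF

  -- The E-sequence shifted to start at 0: exponents n = a (n+1).
  exponents : ℕ → ℕ
  exponents n = F (suc n) ∸ F n

  exponents-positive : ∀ n → 1 ≤ exponents n
  exponents-positive n = m<n⇒0<n∸m (F-increasing n)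

  module _ (xs : ℕ → ℕ) (step : ∀ n → CollatzStep exponents xs n) where
    open CollatzOrbit exponents exponents-positive xs step
    open BalancedRows (λ i k → carry i (suc k)) (λ i k → carry≤1 i (suc k)) carry-no-crossing

    F-telescope : ∀ u s → F (u + s) ≡ F u + G u s
    F-telescope = telescope F (λ n → <⇒≤ (F-increasing n))

    G-carry : ∀ u s → G u s ≡ F s + carry u s
    G-carry u s = +-cancelˡ-≡ (F u) _ _
      (trans (sym (F-telescope u s)) (trans (F-split u s) (+-assoc (F u) (F s) (carry u s))))

    equal-rows⇒equal-blocks : ∀ {i j} L → (∀ k → k < L → carry i (suc k) ≡ carry j (suc k)) →
                              ∀ s → s ≤ L → G i s ≡ G j s
    equal-rows⇒equal-blocks L rows zero    _   = refl
    equal-rows⇒equal-blocks {i} {j} L rows (suc k) k<L =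
      trans (G-carry i (suc k)) (trans (cong (F (suc k) +_) (rows k k<L)) (sym (G-carry j (suc k))))

    -- Rows agreeing on [0, W) at i < j ≤ W+1 give equal exponent blocks of length W,
    -- so x_i = x_j by the collision lemma: the orbit enters a cycle of length j - i.
    cycle-from-rows : (∃ λ i → ∃ λ j → i < j × j ≤ suc W ×
                        (∀ k → k < W → carry i (suc k) ≡ carry j (suc k))) →
                      ∃ λ i → ∃ λ e → xs (i + suc e) ≡ xs i
    cycle-from-rows (i , j , i<j , j≤W+1 , rows) = i , j ∸ suc i , (begin
      xs (i + suc (j ∸ suc i))   ≡⟨ cong xs (trans (+-suc i (j ∸ suc i)) (m+[n∸m]≡n i<j)) ⟩
      xs j                       ≡⟨ sym (collision i j W (equal-rows⇒equal-blocks W rows) xs-i+W-small xs-j+W-small) ⟩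
      xs i                       ∎)
      where
      open ≡-Reasoning
      xs-i+W-small : xs (i + W) < 3 ^ W
      xs-i+W-small = bounded-on-window (i + W) (+-monoˡ-≤ W (≤-trans (<⇒≤ i<j) j≤W+1))
      xs-j+W-small : xs (j + W) < 3 ^ W
      xs-j+W-small = bounded-on-window (j + W) (+-monoˡ-≤ W j≤W+1)

    orbit-cycles : ∃ λ i → ∃ λ e → xs (i + suc e) ≡ xs i
    orbit-cycles = cycle-from-rows (repeated-prefix W)

    -- A cycle of length d = e+1 and total exponent D = G i d has 3^d ≤ 2^D and
    -- makes F increase by exactly D every d steps from i on.
    no-cycle : LtLog2of3 θ → (∃ λ i → ∃ λ e → xs (i + suc e) ≡ xs i) → ⊥
    no-cycle lg (i , e , cyc) = no-steep-progression lg i e (G i (suc e)) (cycle-growth cyc)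
      (λ t → trans (F-telescope i (t * suc e)) (cong (F i +_) (cycle-exponents cyc t)))

-- The exponents are positive and no orbit has them.
theorem4p14 : (θ : Real) → OneLe θ → LtLog2of3 θ →
    (F : ℕ → ℕ) → IsFloorMul θ F →
    ΩDivergent (λ n → F n ∸ F (n ∸ 1))
theorem4p14 θ one lg F isF =
  exponents-positive , λ { (_ , _ , xs , _ , step) → no-cycle xs step lg (orbit-cycles xs step) }
  where open NoOrbit θ one F isF
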